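{- Let $t\geq 0$ and consider the rectangle with $2$ rows and $3t+4$ columns, whose unit squares are labelled $(i,j)$ with row $i\in\{1,2\}$ (counted from the top) and column $j\in\{1,\dots,3t+4\}$ (counted from the left). (a) If a vertical domino $\{(1,c),(2,c)\}$ is removed, the remaining region can be tiled by right trominoes if and only if $c=3k+1$ for some integer $k\geq 0$. (b) If a horizontal domino is removed, the remaining region can be tiled by right trominoes if and only if the domino is $\{(1,3x+2),(1,3x+3)\}$ or $\{(2,3x+2),(2,3x+3)\}$ for some integer $x\geq 0$.
   Context: A right tromino is the L-shaped figure formed by three unit squares ($2\times 2$ square minus one unit square), in any rotation. A tiling of a region by right trominoes is a covering of it by grid-aligned copies with disjoint interiors. A domino is a pair of edge-adjacent unit squares. -}

module Defs where

open import Data.Nat using (ℕ; _+_; _*_; _≤_)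
open import Data.Fin using (Fin; toℕ)
open import Data.Product using (_×_; _,_; ∃; Σ)
open import Data.List using (List; length; lookup)
open import Relation.Binary.PropositionalEquality using (_≡_; _≢_)

-- A unit square (cell) is (row , column), 1-indexed as in the paper.
Cell : Set
Cell = ℕ × ℕ

Region : Set₁
Region = Cell → Set

-- A right tromino: the 2×2 block with top-left cell (row , col),
-- minus the cell at offset 'missing' (row offset , column offset).
record Tromino : Set where
  constructor tromino
  field
    row     : ℕ
    col     : ℕ
    missing : Fin 2 × Fin 2

open Tromino public

_∈T_ : Cell → Tromino → Set
x ∈T T = Σ (Fin 2) λ a → Σ (Fin 2) λ b →
           (x ≡ (row T + toℕ a , col T + toℕ b)) × ((a , b) ≢ missing T)

IsTiling : Region → List Tromino → Set
IsTiling R ts =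
  (∀ (k : Fin (length ts)) (x : Cell) → x ∈T lookup ts k → R x) ×
  (∀ (x : Cell) → R x →
     Σ (Fin (length ts)) λ k → (x ∈T lookup ts k) ×
       (∀ (k' : Fin (length ts)) → x ∈T lookup ts k' → k' ≡ k))

Tileable : Region → Set
Tileable R = Σ (List Tromino) λ ts → IsTiling R ts

Rect : ℕ → Region
Rect t (i , j) = (1 ≤ i × i ≤ 2) × (1 ≤ j × j ≤ 3 * t + 4)

RectMinus : ℕ → Cell → Cell → Region
RectMinus t d₁ d₂ x = Rect t x × (x ≢ d₁) × (x ≢ d₂)

-- Two trominoes tile a 2 × 3 block, hence every 2 × 3n strip. Removing the
-- vertical domino in column 3k + 1 leaves strips of 3k and 3u columns; removing a horizontal domino in columns
-- 3x + 2, 3x + 3 leaves strips of 3x and 3u columns around a 2 × 4 block minus the middle of one row, which two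
-- trominoes tile.
--
-- For the negative half, every tromino occupies two consecutive columns, so a tiling may have faults: vertical
-- lines crossed by no tromino. There is a fault left of column 1. If there is a fault left of column m + 1 and
-- columns m + 1, m + 2 are complete, the tromino covering (1, m + 1) covers all of column m + 1 and one cell of
-- column m + 2; the tromino covering the other cell of column m + 2 then lies in columns m + 2, m + 3, so column
-- m + 3 is complete and has a fault on its right. Hence there are faults left of columns 1, 4, 7, … up to the
-- removed domino, and the tromino just right of the last of them rules out every other position of the domino.
module Submission where

open import Defs
open import Data.Nat using (ℕ; zero; suc; _+_; _*_; _≤_; _<_; z≤n; s≤s; _≤?_; _<?_; _≟_)
open import Data.Nat.Properties
open import Algebra.Properties.CommutativeSemigroup +-commutativeSemigroup using (xy∙z≈xz∙y)
open import Data.Nat.Tactic.RingSolver using (solve-∀)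
open import Data.Fin using (Fin; zero; suc; toℕ; fromℕ<)
import Data.Fin.Properties as Fin
open import Data.Product using (_×_; _,_; Σ; ∃; proj₁; proj₂)
open import Data.Product.Properties using (≡-dec)
open import Data.Sum using (_⊎_; inj₁; inj₂; [_,_]′)
import Data.Sum as Sum
open import Data.Empty using (⊥-elim)
open import Data.List using (List; []; _∷_; _++_; map; length; lookup)
open import Data.List.Relation.Unary.All as All using (All; []; _∷_)
import Data.List.Relation.Unary.All.Properties as All
open import Relation.Unary using (_⊆_; _≐_; _∪_; _⊥_; Decidable)
open import Relation.Unary.Properties using (≐-trans; ≐-sym)
open import Relation.Nullary using (¬_; Dec; yes; no)
open import Relation.Nullary.Decidable using (_×-dec_; _→-dec_; ¬?; True; toWitness; map′)
open import Relation.Binary.PropositionalEquality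
open import Function.Bundles using (_⇔_; mk⇔)

pattern 0F = zero
pattern 1F = suc zero

Offset : Set
Offset = Fin 2 × Fin 2

_≟ᵒ_ : (p q : Offset) → Dec (p ≡ q)
_≟ᵒ_ = ≡-dec Fin._≟_ Fin._≟_

_≟ᶜ_ : (x y : Cell) → Dec (x ≡ y)
_≟ᶜ_ = ≡-dec _≟_ _≟_

cellOf : Tromino → Offset → Cell
cellOf T (a , b) = (row T + toℕ a , col T + toℕ b)

∈T-cellOf : ∀ T {p} → p ≢ missing T → cellOf T p ∈T T
∈T-cellOf T {a , b} p≢missing = a , b , refl , p≢missing

∈T-one-of : ∀ T {p q} → p ≢ q → cellOf T p ∈T T ⊎ cellOf T q ∈T T
∈T-one-of T {p} {q} p≢q with p ≟ᵒ missing T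
... | no  p≢missing = inj₁ (∈T-cellOf T p≢missing)
... | yes refl      = inj₂ (∈T-cellOf T λ q≡p → p≢q (sym q≡p))

_∈T?_ : ∀ x T → Dec (x ∈T T)
x ∈T? T = Fin.any? λ a → Fin.any? λ b → (x ≟ᶜ cellOf T (a , b)) ×-dec ¬? ((a , b) ≟ᵒ missing T)

-- Tilings as lists of trominoes

data ExactlyOne {A : Set} (P : A → Set) : List A → Set where
  here  : ∀ {a as} → P a → All (λ b → ¬ P b) as → ExactlyOne P (a ∷ as)
  there : ∀ {a as} → ¬ P a → ExactlyOne P as → ExactlyOne P (a ∷ as)

lookupᶠ : ∀ {A : Set} {P : A → Set} {as} → All P as → (k : Fin (length as)) → P (lookup as k)
lookupᶠ (p ∷ ps) zero    = p
lookupᶠ (p ∷ ps) (suc k) = lookupᶠ ps k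

module _ {A : Set} {P : A → Set} where

  ExactlyOne⇒uniqueIndex : ∀ {as} → ExactlyOne P as →
    Σ (Fin (length as)) λ k → P (lookup as k) × (∀ k′ → P (lookup as k′) → k′ ≡ k)
  ExactlyOne⇒uniqueIndex (here p none) = zero , p , λ
    { zero    _ → refl
    ; (suc k) q → ⊥-elim (lookupᶠ none k q) }
  ExactlyOne⇒uniqueIndex (there ¬p one) with ExactlyOne⇒uniqueIndex one
  ... | k , p , unique = suc k , p , λ
    { zero     q → ⊥-elim (¬p q)
    ; (suc k′) q → cong suc (unique k′ q) }

  ExactlyOne-++⁺ˡ : ∀ {as bs} → ExactlyOne P as → All (λ b → ¬ P b) bs → ExactlyOne P (as ++ bs)
  ExactlyOne-++⁺ˡ (here p none)  nones = here p (All.++⁺ none nones)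
  ExactlyOne-++⁺ˡ (there ¬p one) nones = there ¬p (ExactlyOne-++⁺ˡ one nones)

  ExactlyOne-++⁺ʳ : ∀ {as bs} → All (λ a → ¬ P a) as → ExactlyOne P bs → ExactlyOne P (as ++ bs)
  ExactlyOne-++⁺ʳ []          one = one
  ExactlyOne-++⁺ʳ (¬p ∷ none) one = there ¬p (ExactlyOne-++⁺ʳ none one)

  exactlyOne? : (∀ a → Dec (P a)) → ∀ as → Dec (ExactlyOne P as)
  exactlyOne? P? [] = no λ ()
  exactlyOne? P? (a ∷ as) with P? a
  ... | yes p  = map′ (here p) (λ { (here _ none) → none ; (there ¬p _) → ⊥-elim (¬p p) })
                      (All.all? (λ b → ¬? (P? b)) as)
  ... | no  ¬p = map′ (there ¬p) (λ { (here p _) → ⊥-elim (¬p p) ; (there _ one) → one }) (exactlyOne? P? as)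

ExactlyOne-map⁺ : ∀ {A B : Set} {P : A → Set} {Q : B → Set} {f : A → B} →
  (∀ {a} → P a → Q (f a)) → (∀ {a} → Q (f a) → P a) →
  ∀ {as} → ExactlyOne P as → ExactlyOne Q (map f as)
ExactlyOne-map⁺ to from (here p none)  = here (to p) (All.map⁺ (All.map (λ ¬p q → ¬p (from q)) none))
ExactlyOne-map⁺ to from (there ¬p one) = there (λ q → ¬p (from q)) (ExactlyOne-map⁺ to from one)

-- An index-free form of IsTiling, which makes tilings easy to concatenate.
Tiles : Region → List Tromino → Set
Tiles R ts = All (λ T → (_∈T T) ⊆ R) ts × (∀ {x} → R x → ExactlyOne (x ∈T_) ts)

Tiles⇒Tileable : ∀ {R ts} → Tiles R ts → Tileable R
Tiles⇒Tileable {ts = ts} (inside , cover) =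
  ts , (λ k x → lookupᶠ inside k) , (λ x r → ExactlyOne⇒uniqueIndex (cover r))

Tiles-resp : ∀ {R S ts} → R ≐ S → Tiles R ts → Tiles S ts
Tiles-resp (R⊆S , S⊆R) (inside , cover) = All.map (λ T⊆R {_} m → R⊆S (T⊆R m)) inside , λ s → cover (S⊆R s)

Tiles-∅ : ∀ {R} → (∀ {x} → ¬ R x) → Tiles R []
Tiles-∅ empty = [] , λ r → ⊥-elim (empty r)

Tiles-∪ : ∀ {R S ts us} → Tiles R ts → Tiles S us → R ⊥ S → Tiles (R ∪ S) (ts ++ us)
Tiles-∪ (insideR , coverR) (insideS , coverS) disjoint =
  All.++⁺ (All.map (λ T⊆R {_} m → inj₁ (T⊆R m)) insideR) (All.map (λ T⊆S {_} m → inj₂ (T⊆S m)) insideS) ,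
  λ { (inj₁ r) → ExactlyOne-++⁺ˡ (coverR r) (All.map (λ T⊆S m → disjoint (r , T⊆S m)) insideS)
    ; (inj₂ s) → ExactlyOne-++⁺ʳ (All.map (λ T⊆R m → disjoint (T⊆R m , s)) insideR) (coverS s) }

-- Bands and their translates

shiftCell : ℕ → Cell → Cell
shiftCell s (i , j) = (i , j + s)

shift : ℕ → Tromino → Tromino
shift s T = tromino (row T) (col T + s) (missing T)

Shifted : ℕ → Region → Region
Shifted s R x = Σ Cell λ y → R y × x ≡ shiftCell s y

shiftCell-injective : ∀ s {x y} → shiftCell s x ≡ shiftCell s y → x ≡ y
shiftCell-injective s {i , j} {i′ , j′} e = cong₂ _,_ (cong proj₁ e) (+-cancelʳ-≡ s j j′ (cong proj₂ e))

module _ {s : ℕ} {T : Tromino} where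

  ∈T-shift⁺ : ∀ {y} → y ∈T T → shiftCell s y ∈T shift s T
  ∈T-shift⁺ (a , b , refl , a,b≢missing) =
    a , b , cong (row T + toℕ a ,_) (xy∙z≈xz∙y (col T) (toℕ b) s) , a,b≢missing

  ∈T-shift⁻ : ∀ {x} → x ∈T shift s T → Σ Cell λ y → y ∈T T × x ≡ shiftCell s y
  ∈T-shift⁻ (a , b , refl , a,b≢missing) =
    (row T + toℕ a , col T + toℕ b) , (a , b , refl , a,b≢missing) ,
    cong (row T + toℕ a ,_) (xy∙z≈xz∙y (col T) s (toℕ b))

  ∈T-shift-cancel : ∀ {y} → shiftCell s y ∈T shift s T → y ∈T T
  ∈T-shift-cancel m with ∈T-shift⁻ m
  ... | y , m′ , e = subst (_∈T T) (sym (shiftCell-injective s e)) m′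

Tiles-shift : ∀ {R ts} s → Tiles R ts → Tiles (Shifted s R) (map (shift s) ts)
Tiles-shift s (inside , cover) =
  All.map⁺ (All.map (λ T⊆R {_} m → let y , m′ , e = ∈T-shift⁻ m in y , T⊆R m′ , e) inside) ,
  λ { (y , r , refl) → ExactlyOne-map⁺ ∈T-shift⁺ ∈T-shift-cancel (cover r) }

Band : ℕ → ℕ → Region
Band a b (i , j) = (1 ≤ i × i ≤ 2) × (a < j × j ≤ b)

_without_ : Region → Cell × Cell → Region
(R without (d₁ , d₂)) x = R x × x ≢ d₁ × x ≢ d₂

Band? : ∀ a b → Decidable (Band a b)
Band? a b (i , j) = ((1 ≤? i) ×-dec (i ≤? 2)) ×-dec ((a <? j) ×-dec (j ≤? b))

without? : ∀ {R} → Decidable R → ∀ d → Decidable (R without d)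
without? R? (d₁ , d₂) x = R? x ×-dec ¬? (x ≟ᶜ d₁) ×-dec ¬? (x ≟ᶜ d₂)

Band-split : ∀ {a b c} → a ≤ b → b ≤ c → Band a c ≐ Band a b ∪ Band b c
Band-split {a} {b} {c} a≤b b≤c = split , join
  where
  split : Band a c ⊆ Band a b ∪ Band b c
  split {i , j} (rows , a<j , j≤c) with j ≤? b
  ... | yes j≤b = inj₁ (rows , a<j , j≤b)
  ... | no  j≰b = inj₂ (rows , ≰⇒> j≰b , j≤c)
  join : Band a b ∪ Band b c ⊆ Band a c
  join (inj₁ (rows , a<j , j≤b)) = rows , a<j , ≤-trans j≤b b≤c
  join (inj₂ (rows , b<j , j≤c)) = rows , ≤-<-trans a≤b b<j , j≤c

Band-disjoint : ∀ {a b b′ c} → b ≤ b′ → Band a b ⊥ Band b′ c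
Band-disjoint b≤b′ ((_ , _ , j≤b) , (_ , b′<j , _)) = <-irrefl refl (≤-<-trans (≤-trans j≤b b≤b′) b′<j)

Shifted-Band : ∀ s {a b} → Shifted s (Band a b) ≐ Band (a + s) (b + s)
Shifted-Band s {a} {b} = to , from
  where
  to : Shifted s (Band a b) ⊆ Band (a + s) (b + s)
  to ((i , j) , (rows , a<j , j≤b) , refl) = rows , +-monoˡ-< s a<j , +-monoˡ-≤ s j≤b
  from : Band (a + s) (b + s) ⊆ Shifted s (Band a b)
  from {i , j} (rows , a+s<j , j≤b+s) with m≤n⇒∃[o]m+o≡n (≤-trans (m≤n+m s a) (<⇒≤ a+s<j))
  ... | o , refl = (i , o) , (rows , a<o , o≤b) , cong (i ,_) (+-comm s o)
    where
    a<o : a < o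
    a<o = +-cancelʳ-< s a o (subst (a + s <_) (+-comm s o) a+s<j)
    o≤b : o ≤ b
    o≤b = +-cancelʳ-≤ s o b (subst (_≤ b + s) (+-comm s o) j≤b+s)

Shifted-without : ∀ s {R d₁ d₂} →
  Shifted s (R without (d₁ , d₂)) ≐ Shifted s R without (shiftCell s d₁ , shiftCell s d₂)
Shifted-without s =
  (λ { (y , (r , ≢₁ , ≢₂) , refl) →
         (y , r , refl) , (λ e → ≢₁ (shiftCell-injective s e)) , (λ e → ≢₂ (shiftCell-injective s e)) }) ,
  (λ { ((y , r , refl) , ≢₁ , ≢₂) → y , (r , (λ { refl → ≢₁ refl }) , (λ { refl → ≢₂ refl })) , refl })

∪-congʳ : ∀ {P Q Q′ : Region} → Q ≐ Q′ → P ∪ Q ≐ P ∪ Q′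
∪-congʳ (Q⊆Q′ , Q′⊆Q) = Sum.map₂ Q⊆Q′ , Sum.map₂ Q′⊆Q

without-cong : ∀ {R S} d → R ≐ S → R without d ≐ S without d
without-cong d (R⊆S , S⊆R) = (λ (r , ≢₁ , ≢₂) → R⊆S r , ≢₁ , ≢₂)
                           , (λ (s , ≢₁ , ≢₂) → S⊆R s , ≢₁ , ≢₂)

without-middle : ∀ {A B C : Region} {d₁ d₂} → A ⊥ B → B ⊥ C → B d₁ → B d₂ →
  (A ∪ (B ∪ C)) without (d₁ , d₂) ≐ A ∪ ((B without (d₁ , d₂)) ∪ C)
without-middle {A} {B} {C} {d₁} {d₂} A⊥B B⊥C Bd₁ Bd₂ = to , from
  where
  to : (A ∪ (B ∪ C)) without (d₁ , d₂) ⊆ A ∪ ((B without (d₁ , d₂)) ∪ C)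
  to (inj₁ a , _)              = inj₁ a
  to (inj₂ (inj₁ b) , ≢₁ , ≢₂) = inj₂ (inj₁ (b , ≢₁ , ≢₂))
  to (inj₂ (inj₂ c) , _)       = inj₂ (inj₂ c)
  from : A ∪ ((B without (d₁ , d₂)) ∪ C) ⊆ (A ∪ (B ∪ C)) without (d₁ , d₂)
  from (inj₁ a)                    = inj₁ a , (λ { refl → A⊥B (a , Bd₁) }) , (λ { refl → A⊥B (a , Bd₂) })
  from (inj₂ (inj₁ (b , ≢₁ , ≢₂))) = inj₂ (inj₁ b) , ≢₁ , ≢₂
  from (inj₂ (inj₂ c))             = inj₂ (inj₂ c) , (λ { refl → B⊥C (Bd₁ , c) }) , (λ { refl → B⊥C (Bd₂ , c) })

-- Explicit tilings

Band-∀ : ∀ {w} {Q : Region} → (∀ (a : Fin 2) (j : Fin w) → Q (1 + toℕ a , 1 + toℕ j)) → ∀ {x} → Band 0 w x → Q x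
Band-∀ {Q = Q} all {suc i , suc j} ((_ , i<2) , _ , j<w) =
  subst Q (cong₂ _,_ (cong suc (Fin.toℕ-fromℕ< i<2)) (cong suc (Fin.toℕ-fromℕ< j<w))) (all (fromℕ< i<2) (fromℕ< j<w))

offsets-inside? : ∀ {R : Region} → Decidable R → ∀ ts →
  Dec (All (λ T → ∀ a b → (a , b) ≢ missing T → R (cellOf T (a , b))) ts)
offsets-inside? R? = All.all? λ T → Fin.all? λ a → Fin.all? λ b → ¬? ((a , b) ≟ᵒ missing T) →-dec R? _

covered? : ∀ {R : Region} → Decidable R → ∀ w ts →
  Dec (∀ (a : Fin 2) (j : Fin w) → R (1 + toℕ a , 1 + toℕ j) → ExactlyOne ((1 + toℕ a , 1 + toℕ j) ∈T_) ts)
covered? R? w ts = Fin.all? λ a → Fin.all? λ j → R? _ →-dec exactlyOne? (λ T → _ ∈T? T) ts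

Tiles-by-decision : ∀ {R : Region} {w} (R? : Decidable R) → R ⊆ Band 0 w → ∀ ts →
  {_ : True (offsets-inside? R? ts ×-dec covered? R? w ts)} → Tiles R ts
Tiles-by-decision {R} R? R⊆Band ts {checked} =
  All.map (λ inside → λ { (a , b , refl , a,b≢missing) → inside a b a,b≢missing }) (proj₁ (toWitness checked)) ,
  λ r → Band-∀ {Q = λ x → R x → ExactlyOne (x ∈T_) ts} (proj₂ (toWitness checked)) (R⊆Band r) r

block : List Tromino
block = tromino 1 1 (0F , 1F) ∷ tromino 1 2 (1F , 0F) ∷ []

block-tiles : Tiles (Band 0 3) block
block-tiles = Tiles-by-decision (Band? 0 3) (λ b → b) block

Gap : Fin 2 → Region
Gap r = Band 0 4 without ((1 + toℕ r , 2) , (1 + toℕ r , 3))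

gap : Fin 2 → List Tromino
gap r = tromino 1 1 (r , 1F) ∷ tromino 1 3 (r , 0F) ∷ []

gap-tiles : ∀ r → Tiles (Gap r) (gap r)
gap-tiles 0F = Tiles-by-decision (without? (Band? 0 4) _) proj₁ (gap 0F)
gap-tiles 1F = Tiles-by-decision (without? (Band? 0 4) _) proj₁ (gap 1F)

strip : ℕ → List Tromino
strip zero    = []
strip (suc n) = block ++ map (shift 3) (strip n)

strip-tiles : ∀ n → Tiles (Band 0 (3 * n)) (strip n)
strip-tiles zero    = Tiles-∅ λ { (_ , 0<j , j≤0) → <-irrefl refl (<-≤-trans 0<j j≤0) }
strip-tiles (suc n) = subst (λ w → Tiles (Band 0 w) (strip (suc n))) (trans (+-comm (3 * n) 3) (sym (*-suc 3 n)))
  (Tiles-resp (≐-sym (Band-split z≤n (m≤n+m 3 (3 * n))))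
    (Tiles-∪ block-tiles (Tiles-resp (Shifted-Band 3) (Tiles-shift 3 (strip-tiles n))) (Band-disjoint ≤-refl)))

shifted-strip-tiles : ∀ a n → Tiles (Band a (3 * n + a)) (map (shift a) (strip n))
shifted-strip-tiles a n = Tiles-resp (Shifted-Band a) (Tiles-shift a (strip-tiles n))

tileable-between-strips : ∀ k g u {d₁ d₂ us} → Band (3 * k) (g + 3 * k) d₁ → Band (3 * k) (g + 3 * k) d₂ →
  Tiles (Band (3 * k) (g + 3 * k) without (d₁ , d₂)) us → Tileable (Band 0 (3 * u + (g + 3 * k)) without (d₁ , d₂))
tileable-between-strips k g u {d₁} {d₂} Bd₁ Bd₂ middle =
  Tiles⇒Tileable (Tiles-resp (≐-sym pieces)
    (Tiles-∪ (strip-tiles k)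
             (Tiles-∪ middle (shifted-strip-tiles (g + 3 * k) u) λ ((b , _) , c) → Band-disjoint ≤-refl (b , c))
             λ { (a , inj₁ (b , _)) → Band-disjoint ≤-refl (a , b)
               ; (a , inj₂ c)       → Band-disjoint (m≤n+m (3 * k) g) (a , c) }))
  where
  pieces : Band 0 (3 * u + (g + 3 * k)) without (d₁ , d₂) ≐
           Band 0 (3 * k) ∪ ((Band (3 * k) (g + 3 * k) without (d₁ , d₂)) ∪ Band (g + 3 * k) (3 * u + (g + 3 * k)))
  pieces = ≐-trans (without-cong _ (≐-trans (Band-split z≤n (≤-trans (m≤n+m (3 * k) g) (m≤n+m _ (3 * u))))
                                            (∪-congʳ (Band-split (m≤n+m (3 * k) g) (m≤n+m _ (3 * u))))))
                   (without-middle (Band-disjoint ≤-refl) (Band-disjoint ≤-refl) Bd₁ Bd₂)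

Band-without-column-tileable : ∀ k u → Tileable (Band 0 (3 * u + (1 + 3 * k)) without ((1 , 1 + 3 * k) , (2 , 1 + 3 * k)))
Band-without-column-tileable k u =
  tileable-between-strips k 1 u ((s≤s z≤n , s≤s z≤n) , ≤-refl , ≤-refl)
                                ((s≤s z≤n , s≤s (s≤s z≤n)) , ≤-refl , ≤-refl)
    (Tiles-∅ λ (b , ≢₁ , ≢₂) → [ ≢₁ , ≢₂ ]′ (column-cells b))
  where
  column-cells : ∀ {x} → Band (3 * k) (1 + 3 * k) x → x ≡ (1 , 1 + 3 * k) ⊎ x ≡ (2 , 1 + 3 * k)
  column-cells {i , j} (rows , 3k<j , j≤1+3k) with ≤-antisym j≤1+3k 3k<j | rows
  ... | refl | s≤s z≤n , s≤s z≤n       = inj₁ refl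
  ... | refl | s≤s z≤n , s≤s (s≤s z≤n) = inj₂ refl

Band-without-domino-tileable : ∀ a x u →
  Tileable (Band 0 (3 * u + (4 + 3 * x)) without ((1 + toℕ a , 2 + 3 * x) , (1 + toℕ a , 3 + 3 * x)))
Band-without-domino-tileable a x u =
  tileable-between-strips x 4 u (rows , m<n+m (3 * x) {2} (s≤s z≤n) , +-monoˡ-≤ (3 * x) {2} {4} (s≤s (s≤s z≤n)))
                                (rows , m<n+m (3 * x) {3} (s≤s z≤n) , +-monoˡ-≤ (3 * x) {3} {4} (s≤s (s≤s (s≤s z≤n))))
    (Tiles-resp (≐-trans (Shifted-without (3 * x)) (without-cong _ (Shifted-Band (3 * x))))
                (Tiles-shift (3 * x) (gap-tiles a)))
  where
  rows : 1 ≤ 1 + toℕ a × 1 + toℕ a ≤ 2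
  rows = s≤s z≤n , s≤s (Fin.toℕ≤pred[n] a)

-- Faults

-- toℕ b + c rather than c + toℕ b, so that offset (a , 1F) lies in column suc c definitionally.
cellAt : ℕ → Offset → Cell
cellAt c (a , b) = (1 + toℕ a , toℕ b + c)

cellAt-injective : ∀ c {p q} → cellAt c p ≡ cellAt c q → p ≡ q
cellAt-injective c {a , b} {a′ , b′} e =
  cong₂ _,_ (Fin.toℕ-injective (suc-injective (cong proj₁ e))) (Fin.toℕ-injective (+-cancelʳ-≡ c _ _ (cong proj₂ e)))

ColumnFull : Region → ℕ → Set
ColumnFull R j = ∀ (a : Fin 2) → R (1 + toℕ a , j)

ColumnsFull : Region → ℕ → Set
ColumnsFull R n = ∀ {j} → j < n → ColumnFull R (suc j)

module ColumnArgument {R : Region} (ts : List Tromino) (tiling : IsTiling R ts) {w : ℕ} (R⊆Band : R ⊆ Band 0 w) where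

  T : Fin (length ts) → Tromino
  T = lookup ts

  inside : ∀ k {x} → x ∈T T k → R x
  inside k m = proj₁ tiling k _ m

  owner : ∀ {x} → R x → Fin (length ts)
  owner {x} r = proj₁ (proj₂ tiling x r)

  ∈T-owner : ∀ {x} (r : R x) → x ∈T T (owner r)
  ∈T-owner {x} r = proj₁ (proj₂ (proj₂ tiling x r))

  same-tromino : ∀ {x k k′} → x ∈T T k → x ∈T T k′ → k ≡ k′
  same-tromino {x} {k} {k′} m m′ with proj₂ tiling x (inside k m)
  ... | _ , _ , unique = trans (unique k m) (sym (unique k′ m′))

  row≡1 : ∀ k → row (T k) ≡ 1
  row≡1 k = ≤-antisym (+-cancelʳ-≤ 1 _ 1 (proj₂ (rows-of (∈T-one-of (T k) {1F , 0F} {1F , 1F} λ ()))))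
                      (subst (1 ≤_) (+-identityʳ _) (proj₁ (rows-of (∈T-one-of (T k) {0F , 0F} {0F , 1F} λ ()))))
    where
    rows-of : ∀ {a} → cellOf (T k) (a , 0F) ∈T T k ⊎ cellOf (T k) (a , 1F) ∈T T k →
              1 ≤ row (T k) + toℕ a × row (T k) + toℕ a ≤ 2
    rows-of (inj₁ m) = proj₁ (R⊆Band (inside k m))
    rows-of (inj₂ m) = proj₁ (R⊆Band (inside k m))

  cellOf≡cellAt : ∀ k {c} p → col (T k) ≡ c → cellOf (T k) p ≡ cellAt c p
  cellOf≡cellAt k (a , b) refl = cong₂ _,_ (cong (_+ toℕ a) (row≡1 k)) (+-comm (col (T k)) (toℕ b))

  ∈T-cellAt⁺ : ∀ k {c p} → col (T k) ≡ c → p ≢ missing (T k) → cellAt c p ∈T T k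
  ∈T-cellAt⁺ k {p = p} col≡c p≢missing = subst (_∈T T k) (cellOf≡cellAt k p col≡c) (∈T-cellOf (T k) p≢missing)

  ∈T-cellAt⁻ : ∀ k {c p} → col (T k) ≡ c → cellAt c p ∈T T k → p ≢ missing (T k)
  ∈T-cellAt⁻ k {c} col≡c (a , b , e , a,b≢missing) p≡missing =
    a,b≢missing (trans (sym (cellAt-injective c (trans e (cellOf≡cellAt k (a , b) col≡c)))) p≡missing)

  ∈T-one-ofᶜ : ∀ k {c p q} → col (T k) ≡ c → p ≢ q → cellAt c p ∈T T k ⊎ cellAt c q ∈T T k
  ∈T-one-ofᶜ k {p = p} {q} col≡c p≢q =
    Sum.map (subst (_∈T T k) (cellOf≡cellAt k p col≡c)) (subst (_∈T T k) (cellOf≡cellAt k q col≡c))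
            (∈T-one-of (T k) p≢q)

  ∈T-col : ∀ k {i j} → (i , j) ∈T T k → col (T k) ≡ j ⊎ suc (col (T k)) ≡ j
  ∈T-col k (_ , 0F , refl , _) = inj₁ (sym (+-identityʳ _))
  ∈T-col k (_ , 1F , refl , _) = inj₂ (+-comm 1 _)

  -- No tromino crosses the vertical line between columns m and m + 1.
  Fault : ℕ → Set
  Fault m = ∀ k → col (T k) ≢ m

  fault-0 : Fault 0
  fault-0 k col≡0 = [ no-column-0 , no-column-0 ]′ (∈T-one-ofᶜ k {p = 0F , 0F} {1F , 0F} col≡0 λ ())
    where
    no-column-0 : ∀ {a} → ¬ cellAt 0 (a , 0F) ∈T T k
    no-column-0 m = <-irrefl refl (proj₁ (proj₂ (R⊆Band (inside k m))))

  col-after-fault : ∀ {m i k} → Fault m → (i , suc m) ∈T T k → col (T k) ≡ suc m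
  col-after-fault {k = k} fault m with ∈T-col k m
  ... | inj₁ col≡ = col≡
  ... | inj₂ suc-col≡ = ⊥-elim (fault k (suc-injective suc-col≡))

  one-of-after-fault : ∀ {m i p q} → Fault m → R (i , suc m) → p ≢ q →
                       R (cellAt (suc m) p) ⊎ R (cellAt (suc m) q)
  one-of-after-fault fault r p≢q =
    Sum.map (inside (owner r)) (inside (owner r)) (∈T-one-ofᶜ (owner r) (col-after-fault fault (∈T-owner r)) p≢q)

  tromino-after-fault : ∀ {m} → Fault m → ColumnFull R (suc m) →
                        Σ _ λ k → col (T k) ≡ suc m × Σ (Fin 2) λ a → missing (T k) ≡ (a , 1F)
  tromino-after-fault {m} fault full = by-missing (missing (T A)) refl
    where
    A : Fin (length ts)
    A = owner (full 0F)
    colA : col (T A) ≡ suc m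
    colA = col-after-fault fault (∈T-owner (full 0F))
    by-missing : ∀ μ → missing (T A) ≡ μ → Σ _ λ k → col (T k) ≡ suc m × Σ (Fin 2) λ a → missing (T k) ≡ (a , 1F)
    by-missing (0F , 0F) missing≡ = ⊥-elim (∈T-cellAt⁻ A colA (∈T-owner (full 0F)) (sym missing≡))
    by-missing (a  , 1F) missing≡ = A , colA , a , missing≡
    by-missing (1F , 0F) missing≡ =
      ⊥-elim (∈T-cellAt⁻ A colA (subst (λ k → (2 , suc m) ∈T T k) B≡A (∈T-owner (full 1F))) (sym missing≡))
      where
      B = owner (full 1F)
      ∈T-A : ∀ {p} → p ≢ (1F , 0F) → cellAt (suc m) p ∈T T A
      ∈T-A p≢ = ∈T-cellAt⁺ A colA λ p≡missing → p≢ (trans p≡missing missing≡)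
      B≡A : B ≡ A
      B≡A = [ (λ m → same-tromino m (∈T-A {0F , 0F} λ ())) , (λ m → same-tromino m (∈T-A {0F , 1F} λ ())) ]′
              (∈T-one-ofᶜ B {p = 0F , 0F} {0F , 1F} (col-after-fault fault (∈T-owner (full 1F))) λ ())

  tromino-beyond : ∀ {m k a} → col (T k) ≡ m → missing (T k) ≡ (a , 1F) → R (cellAt m (a , 1F)) →
                   Σ _ λ k′ → col (T k′) ≡ suc m × ∀ b → cellAt (suc m) (b , 1F) ∈T T k′
  tromino-beyond {m} {k} {a} colk missing≡ r = C , colC , covers
    where
    C : Fin (length ts)
    C = owner r
    ∈T-k : ∀ {p} → p ≢ (a , 1F) → cellAt m p ∈T T k
    ∈T-k p≢ = ∈T-cellAt⁺ k colk λ p≡missing → p≢ (trans p≡missing missing≡)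
    C≢k : C ≢ k
    C≢k C≡k = ∈T-cellAt⁻ k colk (subst (λ k′ → cellAt m (a , 1F) ∈T T k′) C≡k (∈T-owner r)) (sym missing≡)
    colC : col (T C) ≡ suc m
    colC with ∈T-col C (∈T-owner r)
    ... | inj₁ colC≡ = colC≡
    ... | inj₂ suc-colC≡ = ⊥-elim (C≢k
          ([ (λ mC → same-tromino mC (∈T-k {0F , 0F} λ ())) , (λ mC → same-tromino mC (∈T-k {1F , 0F} λ ())) ]′
            (∈T-one-ofᶜ C {p = 0F , 0F} {1F , 0F} (suc-injective suc-colC≡) λ ())))
    covers : ∀ b → cellAt (suc m) (b , 1F) ∈T T C
    covers b with (b , 1F) ≟ᵒ missing (T C)
    ... | no  b,1≢missing = ∈T-cellAt⁺ C colC b,1≢missing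
    ... | yes b,1≡missing = ⊥-elim (C≢k ([ clash , clash ]′ (∈T-one-ofᶜ k {p = 0F , 1F} {1F , 1F} colk λ ())))
      where
      clash : ∀ {a′} → cellAt m (a′ , 1F) ∈T T k → C ≡ k
      clash = same-tromino (∈T-cellAt⁺ C colC λ a′,0≡missing →
                              Fin.0≢1+n (cong proj₂ (trans a′,0≡missing (sym b,1≡missing))))

  fault-after : ∀ {n k} → col (T k) ≡ n → (∀ b → cellAt n (b , 1F) ∈T T k) → Fault (suc n)
  fault-after {n} {k} colk covers k′ colk′ = 1+n≢n (trans (sym colk′) (trans (cong (λ k → col (T k)) k′≡k) colk))
    where
    k′≡k : k′ ≡ k
    k′≡k = [ (λ m′ → same-tromino m′ (covers 0F)) , (λ m′ → same-tromino m′ (covers 1F)) ]′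
             (∈T-one-ofᶜ k′ {p = 0F , 0F} {1F , 0F} colk′ λ ())

  fault-step : ∀ {m} → Fault m → ColumnFull R (1 + m) → ColumnFull R (2 + m) → Fault (3 + m) × ColumnFull R (3 + m)
  fault-step fault full₁ full₂ with tromino-after-fault fault full₁
  ... | k , colk , a , missing≡ with tromino-beyond colk missing≡ (full₂ a)
  ... | k′ , colk′ , covers = fault-after colk′ covers , λ b → inside k′ (covers b)

  fault-at-3* : ∀ n → ColumnsFull R (3 * n) → Fault (3 * n)
  fault-at-3* zero    _    = fault-0
  fault-at-3* (suc n) full rewrite *-suc 3 n =
    proj₁ (fault-step (fault-at-3* n λ j<3n → full (<-≤-trans j<3n (m≤n+m _ 3)))
                      (full (m<n+m (3 * n) {3} (s≤s z≤n)))
                      (full (s≤s (m<n+m (3 * n) {2} (s≤s z≤n)))))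

  column-full-3*+3 : ∀ n → ColumnsFull R (2 + 3 * n) → ColumnFull R (3 + 3 * n)
  column-full-3*+3 n full =
    proj₂ (fault-step (fault-at-3* n λ j<3n → full (<-≤-trans j<3n (m≤n+m _ 2)))
                      (full (m<n+m (3 * n) {2} (s≤s z≤n)))
                      (full ≤-refl))

  column-nonempty-3*+2 : ∀ n → ColumnsFull R (1 + 3 * n) → R (1 , 2 + 3 * n) ⊎ R (2 , 2 + 3 * n)
  column-nonempty-3*+2 n full =
    one-of-after-fault {p = 0F , 1F} {1F , 1F} (fault-at-3* n λ j<3n → full (<-≤-trans j<3n (n≤1+n _)))
                       (full ≤-refl 0F) λ ()

  domino-nonempty-3*+1 : ∀ n {i} → ColumnsFull R (3 * n) → R (i , 1 + 3 * n) →
                         ∀ a → R (1 + toℕ a , 1 + 3 * n) ⊎ R (1 + toℕ a , 2 + 3 * n)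
  domino-nonempty-3*+1 n full r a =
    one-of-after-fault {p = a , 0F} {a , 1F} (fault-at-3* n full) r λ e → Fin.0≢1+n (cong proj₂ e)

-- Positions of the removed domino

data Residue3 : ℕ → Set where
  [3*_]   : ∀ j → Residue3 (3 * j)
  [1+3*_] : ∀ j → Residue3 (1 + 3 * j)
  [2+3*_] : ∀ j → Residue3 (2 + 3 * j)

residue3 : ∀ n → Residue3 n
residue3 zero = [3* 0 ]
residue3 (suc n) with residue3 n
... | [3* j ]   = [1+3* j ]
... | [1+3* j ] = [2+3* j ]
... | [2+3* j ] = subst Residue3 (*-suc 3 j) [3* suc j ]

intact-columns : ∀ {w n d₁ d₂} → n < w → n < proj₂ d₁ → n < proj₂ d₂ →
                 ColumnsFull (Band 0 w without (d₁ , d₂)) n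
intact-columns {n = n} n<w n<d₁ n<d₂ {j} j<n a =
  ((s≤s z≤n , s≤s (Fin.toℕ≤pred[n] a)) , s≤s z≤n , ≤-trans j<n (<⇒≤ n<w)) , left-of n<d₁ , left-of n<d₂
  where
  left-of : ∀ {d} → n < proj₂ d → (1 + toℕ a , suc j) ≢ d
  left-of n<d refl = <-irrefl refl (<-≤-trans n<d j<n)

Band-without-column-tileable⇒ : ∀ {w c} → 1 ≤ c → c ≤ w →
  Tileable (Band 0 w without ((1 , c) , (2 , c))) → ∃ λ k → c ≡ 3 * k + 1
Band-without-column-tileable⇒ {c = suc c} _ c<w (ts , tiling) with residue3 c
... | [3* k ] = k , +-comm 1 (3 * k)
... | [1+3* n ] = ⊥-elim ([ (λ r → proj₁ (proj₂ r) refl) , (λ r → proj₂ (proj₂ r) refl) ]′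
                            (column-nonempty-3*+2 n (intact-columns c<w ≤-refl ≤-refl)))
  where open ColumnArgument ts tiling proj₁
... | [2+3* n ] = ⊥-elim (proj₁ (proj₂ (column-full-3*+3 n (intact-columns c<w ≤-refl ≤-refl) 0F)) refl)
  where open ColumnArgument ts tiling proj₁

other-row : ∀ (a : Fin 2) → Σ (Fin 2) λ a′ → toℕ a′ ≢ toℕ a
other-row 0F = 1F , λ ()
other-row 1F = 0F , λ ()

Band-without-domino-tileable⇒ : ∀ {w c} (a : Fin 2) → 1 ≤ c → c + 1 ≤ w →
  Tileable (Band 0 w without ((1 + toℕ a , c) , (1 + toℕ a , c + 1))) → ∃ λ x → c ≡ 3 * x + 2
Band-without-domino-tileable⇒ {w} {suc c} a _ c+1≤w (ts , tiling)
  with residue3 c | ≤-trans (m≤m+n (suc c) 1) c+1≤w | other-row a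
... | [3* n ] | c<w | a′ , a′≢a =
  ⊥-elim ([ (λ r → proj₁ (proj₂ r) refl) , (λ r → proj₂ (proj₂ r) (cong (1 + toℕ a ,_) (+-comm 1 (1 + 3 * n)))) ]′
            (domino-nonempty-3*+1 n (intact-columns c<w ≤-refl (m≤m+n _ 1)) other-cell a))
  where
  open ColumnArgument ts tiling proj₁
  other-cell : (Band 0 w without ((1 + toℕ a , 1 + 3 * n) , (1 + toℕ a , 1 + 3 * n + 1))) (1 + toℕ a′ , 1 + 3 * n)
  other-cell = ((s≤s z≤n , s≤s (Fin.toℕ≤pred[n] a′)) , s≤s z≤n , c<w) ,
               (λ e → a′≢a (suc-injective (cong proj₁ e))) , (λ e → a′≢a (suc-injective (cong proj₁ e)))
... | [1+3* n ] | _   | _ = n , +-comm 2 (3 * n)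
... | [2+3* n ] | c<w | _ = ⊥-elim (proj₁ (proj₂ (column-full-3*+3 n (intact-columns c<w ≤-refl (m≤m+n _ 1)) a)) refl)
  where open ColumnArgument ts tiling proj₁

3t+4≡3[1+t]+1 : ∀ t → 3 * t + 4 ≡ 3 * suc t + 1
3t+4≡3[1+t]+1 = solve-∀

strips-beyond-column : ∀ t k → 3 * k + 1 ≤ 3 * t + 4 → ∃ λ u → 3 * t + 4 ≡ 3 * u + (1 + 3 * k)
strips-beyond-column t k c≤w
  with m≤n⇒∃[o]m+o≡n (*-cancelˡ-≤ {k} {suc t} 3 (+-cancelʳ-≤ 1 (3 * k) (3 * suc t)
                                    (subst (3 * k + 1 ≤_) (3t+4≡3[1+t]+1 t) c≤w)))
... | u , k+u≡1+t = u , trans (3t+4≡3[1+t]+1 t) (trans (cong (λ n → 3 * n + 1) (sym k+u≡1+t)) (regroup k u))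
  where
  regroup : ∀ k u → 3 * (k + u) + 1 ≡ 3 * u + (1 + 3 * k)
  regroup = solve-∀

strips-beyond-domino : ∀ t x → 3 * x + 2 + 1 ≤ 3 * t + 4 → ∃ λ u → 3 * t + 4 ≡ 3 * u + (4 + 3 * x)
strips-beyond-domino t x c+1≤w with strips-beyond-column t x (≤-trans (+-monoˡ-≤ 1 (m≤m+n (3 * x) 2)) c+1≤w)
... | suc u , w≡ = u , trans w≡ (regroup u x)
  where
  regroup : ∀ u x → 3 * suc u + (1 + 3 * x) ≡ 3 * u + (4 + 3 * x)
  regroup = solve-∀
... | zero , w≡ = ⊥-elim (m+1+n≰m (1 + 3 * x) (subst₂ _≤_ (regroup x) w≡ c+1≤w))
  where
  regroup : ∀ x → 3 * x + 2 + 1 ≡ 1 + 3 * x + 2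
  regroup = solve-∀

Rect-without-column-tileable : ∀ t k → 3 * k + 1 ≤ 3 * t + 4 → Tileable (RectMinus t (1 , 3 * k + 1) (2 , 3 * k + 1))
Rect-without-column-tileable t k c≤w with strips-beyond-column t k c≤w
... | u , w≡ = subst₂ (λ w c → Tileable (Band 0 w without ((1 , c) , (2 , c)))) (sym w≡) (+-comm 1 (3 * k))
                      (Band-without-column-tileable k u)

Rect-without-domino-tileable : ∀ t x (a : Fin 2) → 3 * x + 2 + 1 ≤ 3 * t + 4 →
  Tileable (RectMinus t (1 + toℕ a , 3 * x + 2) (1 + toℕ a , 3 * x + 2 + 1))
Rect-without-domino-tileable t x a c+1≤w with strips-beyond-domino t x c+1≤w
... | u , w≡ = subst₂ (λ w d → Tileable (Band 0 w without d)) (sym w≡)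
                      (cong₂ _,_ (cong (1 + toℕ a ,_) (+-comm 2 (3 * x))) (cong (1 + toℕ a ,_) (regroup x)))
                      (Band-without-domino-tileable a x u)
  where
  regroup : ∀ x → 3 + 3 * x ≡ 3 * x + 2 + 1
  regroup = solve-∀

DominoAt : ℕ → ℕ → ℕ → Set
DominoAt i c x = ((i , c) ≡ (1 , 3 * x + 2) × (i , c + 1) ≡ (1 , 3 * x + 3))
               ⊎ ((i , c) ≡ (2 , 3 * x + 2) × (i , c + 1) ≡ (2 , 3 * x + 3))

row-index : ∀ {i} → 1 ≤ i → i ≤ 2 → Σ (Fin 2) λ a → i ≡ 1 + toℕ a
row-index (s≤s z≤n) (s≤s z≤n)       = 0F , refl
row-index (s≤s z≤n) (s≤s (s≤s z≤n)) = 1F , refl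

Rect-without-domino-tileable⇒DominoAt : ∀ t {i c} → 1 ≤ i → i ≤ 2 → 1 ≤ c → c + 1 ≤ 3 * t + 4 →
  Tileable (RectMinus t (i , c) (i , c + 1)) → ∃ (DominoAt i c)
Rect-without-domino-tileable⇒DominoAt t 1≤i i≤2 1≤c c+1≤w tileable with row-index 1≤i i≤2
... | a , refl with Band-without-domino-tileable⇒ a 1≤c c+1≤w tileable
... | x , refl = x , at a
  where
  at : ∀ a → DominoAt (1 + toℕ a) (3 * x + 2) x
  at 0F = inj₁ (refl , cong (1 ,_) (+-assoc (3 * x) 2 1))
  at 1F = inj₂ (refl , cong (2 ,_) (+-assoc (3 * x) 2 1))

DominoAt⇒Rect-without-domino-tileable : ∀ t {i c} → c + 1 ≤ 3 * t + 4 → ∃ (DominoAt i c) →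
  Tileable (RectMinus t (i , c) (i , c + 1))
DominoAt⇒Rect-without-domino-tileable t c+1≤w (x , inj₁ (refl , _)) = Rect-without-domino-tileable t x 0F c+1≤w
DominoAt⇒Rect-without-domino-tileable t c+1≤w (x , inj₂ (refl , _)) = Rect-without-domino-tileable t x 1F c+1≤w

theorem4 : (∀ (t c : ℕ) → 1 ≤ c → c ≤ 3 * t + 4 →
             (Tileable (RectMinus t (1 , c) (2 , c)) ⇔ ∃ λ (k : ℕ) → c ≡ 3 * k + 1))
           × (∀ (t i c : ℕ) → 1 ≤ i → i ≤ 2 → 1 ≤ c → c + 1 ≤ 3 * t + 4 →
             (Tileable (RectMinus t (i , c) (i , c + 1)) ⇔
               ∃ λ (x : ℕ) → ((i , c) ≡ (1 , 3 * x + 2) × (i , c + 1) ≡ (1 , 3 * x + 3))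
                           ⊎ ((i , c) ≡ (2 , 3 * x + 2) × (i , c + 1) ≡ (2 , 3 * x + 3))))
theorem4 =
  (λ t c 1≤c c≤w → mk⇔ (Band-without-column-tileable⇒ 1≤c c≤w)
                       λ { (k , refl) → Rect-without-column-tileable t k c≤w }) ,
  (λ t i c 1≤i i≤2 1≤c c+1≤w → mk⇔ (Rect-without-domino-tileable⇒DominoAt t 1≤i i≤2 1≤c c+1≤w)
                                     (DominoAt⇒Rect-without-domino-tileable t c+1≤w))
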